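{- For every positive integer $n$, both polynomials $R_n^{B,+}(t)$ and $R_n^{B,- }(t)$ are divisible by $(1+t)^m$, where $m=\lfloor (n-1)/2\rfloor$.
   Context: $\mathfrak{B}_n$ is the group of signed permutations in window notation $\pi=\pi_1\cdots\pi_n$ ($\pi_i\in\{\pm1,\dots,\pm n\}$, $\{|\pi_i|\}=[n]$), with $\mathrm{inv}_B(\pi)=|\{i<j:\pi_i>\pi_j\}|+|\{i<j:-\pi_i>\pi_j\}|+|\{i:\pi_i<0\}|$. Set $\pi_0=0$; $\mathrm{pk}_B(\pi)$ is the number of $i\in\{1,\dots,n-1\}$ with $\pi_{i-1}<\pi_i>\pi_{i+1}$, $\mathrm{val}_B(\pi)$ the number of $i\in\{1,\dots,n-1\}$ with $\pi_{i-1}>\pi_i<\pi_{i+1}$, and $\mathrm{altruns}_B(\pi)=\mathrm{pk}_B(\pi)+\mathrm{val}_B(\pi)+1$. Let $\mathfrak{B}_n^+$ be the set of $\pi$ with $\mathrm{inv}_B(\pi)$ even and $\mathfrak{B}_n^-=\mathfrak{B}_n\setminus\mathfrak{B}_n^+$. Define $R_n^{B,\pm}(t)=\sum_{\pi\in\mathfrak{B}_n^{\pm}}t^{\mathrm{altruns}_B(\pi)}$. -}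

module Defs where

open import Data.Nat as ℕ using (ℕ; zero; suc; ⌊_/2⌋; _∸_)
open import Data.Integer as ℤ using (ℤ; +_; -_; ∣_∣)
open import Data.Bool using (Bool) renaming (_≟_ to _≟ᵇ_)
open import Data.Bool using (true; false; if_then_else_; _∧_; _∨_; not)
open import Data.List using (List; []; _∷_; _++_; map; concatMap; filter; length; foldr; upTo; applyUpTo; replicate)
open import Data.Product using (Σ; _,_)
open import Relation.Binary.PropositionalEquality using (_≡_)
open import Relation.Nullary.Decidable using (does)

-- Polynomials with integer coefficients, as coefficient lists
-- (constant term first).  Two lists denote the same polynomial iff all
-- their coefficients agree (trailing zeros are irrelevant).

Poly : Set
Poly = List ℤ

coeff : Poly → ℕ → ℤ
coeff []       _       = + 0
coeff (a ∷ _)  zero    = a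
coeff (_ ∷ p)  (suc k) = coeff p k

addP : Poly → Poly → Poly
addP []       q        = q
addP p        []       = p
addP (a ∷ p)  (b ∷ q)  = (a ℤ.+ b) ∷ addP p q

scaleP : ℤ → Poly → Poly
scaleP c = map (c ℤ.*_)

mulP : Poly → Poly → Poly
mulP []       q = []
mulP (a ∷ p)  q = addP (scaleP a q) (+ 0 ∷ mulP p q)

powP : Poly → ℕ → Poly
powP p zero    = + 1 ∷ []
powP p (suc k) = mulP p (powP p k)

monomial : ℕ → Poly
monomial k = replicate k (+ 0) ++ (+ 1 ∷ [])

onePlusT : Poly
onePlusT = + 1 ∷ + 1 ∷ []

_∣P_ : Poly → Poly → Set
d ∣P p = Σ Poly (λ q → ∀ k → coeff p k ≡ coeff (mulP d q) k)

-- Signed permutations in window notation, as lists of integers.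

_<ᵇ_ : ℤ → ℤ → Bool
a <ᵇ b = does (a ℤ.<? b)

_>ᵇ_ : ℤ → ℤ → Bool
a >ᵇ b = b <ᵇ a

count : {A : Set} → (A → Bool) → List A → ℕ
count p []       = 0
count p (x ∷ xs) = (if p x then 1 else 0) ℕ.+ count p xs

listsOf : {A : Set} → ℕ → List A → List (List A)
listsOf zero    xs = [] ∷ []
listsOf (suc n) xs = concatMap (λ x → map (x ∷_) (listsOf n xs)) xs

signedVals : ℕ → List ℤ
signedVals n = applyUpTo (λ i → + suc i) n ++ applyUpTo (λ i → - (+ suc i)) n

memℕ : ℕ → List ℕ → Bool
memℕ x []       = false
memℕ x (y ∷ ys) = does (x ℕ.≟ y) ∨ memℕ x ys

distinct : List ℕ → Bool
distinct []       = true
distinct (x ∷ xs) = not (memℕ x xs) ∧ distinct xs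

-- 𝔅_n : words π₁⋯πₙ with πᵢ ∈ {±1,…,±n} and {|πᵢ|} = [n]
-- (for length-n words over {±1,…,±n} the latter is equivalent to the
-- absolute values being pairwise distinct)
B : ℕ → List (List ℤ)
B n = filter (λ w → distinct (map ∣_∣ w) ≟ᵇ true) (listsOf n (signedVals n))

invB : List ℤ → ℕ
invB []       = 0
invB (x ∷ xs) =
  count (λ y → x >ᵇ y) xs ℕ.+ count (λ y → (- x) >ᵇ y) xs
  ℕ.+ (if x <ᵇ (+ 0) then 1 else 0) ℕ.+ invB xs

-- peaks / valleys over consecutive triples (π_{i-1}, πᵢ, π_{i+1})
-- of the word 0 π₁ ⋯ πₙ, i.e. for i ∈ {1,…,n-1} with π₀ = 0
pkTriples : List ℤ → ℕ
pkTriples (a ∷ b ∷ c ∷ xs) =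
  (if (a <ᵇ b) ∧ (b >ᵇ c) then 1 else 0) ℕ.+ pkTriples (b ∷ c ∷ xs)
pkTriples _ = 0

valTriples : List ℤ → ℕ
valTriples (a ∷ b ∷ c ∷ xs) =
  (if (a >ᵇ b) ∧ (b <ᵇ c) then 1 else 0) ℕ.+ valTriples (b ∷ c ∷ xs)
valTriples _ = 0

pkB : List ℤ → ℕ
pkB π = pkTriples (+ 0 ∷ π)

valB : List ℤ → ℕ
valB π = valTriples (+ 0 ∷ π)

altrunsB : List ℤ → ℕ
altrunsB π = pkB π ℕ.+ valB π ℕ.+ 1

isEven : ℕ → Bool
isEven zero          = true
isEven (suc zero)    = false
isEven (suc (suc k)) = isEven k

Bplus : ℕ → List (List ℤ)
Bplus n = filter (λ π → isEven (invB π) ≟ᵇ true) (B n)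

Bminus : ℕ → List (List ℤ)
Bminus n = filter (λ π → isEven (invB π) ≟ᵇ false) (B n)

altrunsPoly : List (List ℤ) → Poly
altrunsPoly = foldr (λ π acc → addP (monomial (altrunsB π)) acc) []

RBplus : ℕ → Poly
RBplus n = altrunsPoly (Bplus n)

RBminus : ℕ → Poly
RBminus n = altrunsPoly (Bminus n)

-- Split a signed permutation into its word of absolute values and its word of signs. Modulo 2, inv_B π
-- is inv |π| plus the number of negative letters, and altruns_B π − 1 is the number of changes in the
-- ascent word of 0 π₁ ⋯ πₙ; each ascent bit depends only on the relative order of two consecutive
-- absolute values and on the two signs involved. It therefore suffices to show that, for a fixed word
-- a₁ ⋯ aₙ of distinct absolute values, the sum of t^(changes) over the sign words with a prescribed parity
-- of negatives is divisible by (1 + t)^⌊(n − 1)/2⌋. This goes by induction, two letters at a time.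
-- Negating all signs of a suffix negates all its ascent bits, so preserves its changes, and shifts the
-- parity of its negatives by its length; when that length is even, the two signs of a letter (or, one
-- letter later, of the next one) contribute p and t p for one and the same polynomial p.

module Submission where

open import Defs
open import Algebra.Bundles using (CommutativeRing)
import Algebra.Properties.CommutativeSemigroup as CommSemigroupProperties
open import Data.Bool using (Bool; true; false; not; _xor_; _∧_; _∨_; if_then_else_; T) renaming (_≟_ to _≟ᵇ_)
open import Data.Bool.Properties
  using ( ∨-conicalˡ; ∨-conicalʳ; ∧-conicalˡ; ∧-conicalʳ; not-injective; not-involutive; not-distribˡ-xor
        ; not-distribʳ-xor; xor-comm; xor-annihilates-not; xor-identityʳ; xor-∧-commutativeRing; if-eta)
open import Data.Empty using (⊥-elim)
open import Data.Integer as ℤ using (ℤ; +_; -[1+_]; ∣_∣)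
import Data.Integer.Properties as ℤ
open import Data.List using (List; []; _∷_; _++_; map; concatMap; length; foldr; filter; zipWith; applyUpTo; upTo)
open import Data.List.Relation.Unary.All as All using (All; []; _∷_)
open import Data.List.Relation.Unary.All.Properties as All using (concat⁺)
open import Data.List.Relation.Unary.AllPairs using (AllPairs; []; _∷_)
open import Data.List.Relation.Unary.Linked using (Linked; []; [-]; _∷_)
open import Data.List.Relation.Unary.Linked.Properties using (AllPairs⇒Linked)
open import Data.Nat as ℕ using (ℕ; zero; suc; _≤_; _∸_; ⌊_/2⌋)
import Data.Nat.Properties as ℕ
open import Data.Product using (_×_; _,_)
open import Function using (_∘_)
open import Relation.Binary using (IsEquivalence; Setoid; tri<; tri≈; tri>)
open import Relation.Binary.PropositionalEquality
import Relation.Binary.Reasoning.Setoid as SetoidReasoning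
open import Relation.Nullary using (Dec; does)
open import Relation.Nullary.Decidable using (dec-true; dec-false)

infix 4 _≈_
record _≈_ (p q : Poly) : Set where
  constructor coeffwise
  field coeff-≡ : ∀ k → coeff p k ≡ coeff q k
open _≈_

≈-isEquivalence : IsEquivalence _≈_
≈-isEquivalence = record
  { refl  = coeffwise λ _ → refl
  ; sym   = λ p≈q → coeffwise λ k → sym (coeff-≡ p≈q k)
  ; trans = λ p≈q q≈r → coeffwise λ k → trans (coeff-≡ p≈q k) (coeff-≡ q≈r k)
  }

≈-setoid : Setoid _ _
≈-setoid = record { isEquivalence = ≈-isEquivalence }

open IsEquivalence ≈-isEquivalence
  using () renaming (refl to ≈-refl; sym to ≈-sym; trans to ≈-trans; reflexive to ≈-reflexive)
module ≈-Reasoning = SetoidReasoning ≈-setoid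

open CommSemigroupProperties ℤ.+-commutativeSemigroup using () renaming (interchange to ℤ-+-interchange)
open CommSemigroupProperties ℕ.+-commutativeSemigroup using () renaming (interchange to ℕ-+-interchange)
open CommSemigroupProperties (CommutativeRing.+-commutativeSemigroup xor-∧-commutativeRing)
  using () renaming (interchange to xor-interchange; xy∙z≈y∙xz to xor-xy∙z≈y∙xz)

t·_ : Poly → Poly
t· p = + 0 ∷ p

t^[_]_ : Bool → Poly → Poly
t^[ b ] p = if b then t· p else p

coeff-addP : ∀ p q k → coeff (addP p q) k ≡ coeff p k ℤ.+ coeff q k
coeff-addP []      q       k       = sym (ℤ.+-identityˡ _)
coeff-addP (a ∷ p) []      k       = sym (ℤ.+-identityʳ _)
coeff-addP (a ∷ p) (b ∷ q) zero    = refl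
coeff-addP (a ∷ p) (b ∷ q) (suc k) = coeff-addP p q k

coeff-scaleP : ∀ c p k → coeff (scaleP c p) k ≡ c ℤ.* coeff p k
coeff-scaleP c []      k       = sym (ℤ.*-zeroʳ c)
coeff-scaleP c (a ∷ p) zero    = refl
coeff-scaleP c (a ∷ p) (suc k) = coeff-scaleP c p k

t·-cong : ∀ {p q} → p ≈ q → t· p ≈ t· q
t·-cong p≈q = coeffwise λ { zero → refl ; (suc k) → coeff-≡ p≈q k }

t·[]≈[] : t· [] ≈ []
t·[]≈[] = coeffwise λ { zero → refl ; (suc k) → refl }

t^-cong : ∀ b {p q} → p ≈ q → t^[ b ] p ≈ t^[ b ] q
t^-cong true  p≈q = t·-cong p≈q
t^-cong false p≈q = p≈q

t^-addP : ∀ b p q → t^[ b ] addP p q ≡ addP (t^[ b ] p) (t^[ b ] q)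
t^-addP true  p q = refl
t^-addP false p q = refl

addP-cong : ∀ {p p′ q q′} → p ≈ p′ → q ≈ q′ → addP p q ≈ addP p′ q′
addP-cong {p} {p′} {q} {q′} p≈p′ q≈q′ = coeffwise λ k →
  trans (coeff-addP p q k) (trans (cong₂ ℤ._+_ (coeff-≡ p≈p′ k) (coeff-≡ q≈q′ k)) (sym (coeff-addP p′ q′ k)))

addP-congʳ : ∀ p {q q′} → q ≈ q′ → addP p q ≈ addP p q′
addP-congʳ p = addP-cong (≈-refl {p})

addP-identityʳ : ∀ p → addP p [] ≈ p
addP-identityʳ p = coeffwise λ k → trans (coeff-addP p [] k) (ℤ.+-identityʳ _)

addP-comm : ∀ p q → addP p q ≈ addP q p
addP-comm p q = coeffwise λ k →
  trans (coeff-addP p q k) (trans (ℤ.+-comm (coeff p k) _) (sym (coeff-addP q p k)))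

addP-assoc : ∀ p q r → addP (addP p q) r ≈ addP p (addP q r)
addP-assoc p q r = coeffwise λ k → begin
  coeff (addP (addP p q) r) k             ≡⟨ coeff-addP (addP p q) r k ⟩
  coeff (addP p q) k ℤ.+ coeff r k        ≡⟨ cong (ℤ._+ coeff r k) (coeff-addP p q k) ⟩
  coeff p k ℤ.+ coeff q k ℤ.+ coeff r k   ≡⟨ ℤ.+-assoc (coeff p k) _ _ ⟩
  coeff p k ℤ.+ (coeff q k ℤ.+ coeff r k) ≡⟨ cong (ℤ._+_ (coeff p k)) (coeff-addP q r k) ⟨
  coeff p k ℤ.+ coeff (addP q r) k        ≡⟨ coeff-addP p (addP q r) k ⟨
  coeff (addP p (addP q r)) k             ∎
  where open ≡-Reasoning

addP-interchange : ∀ p q r s → addP (addP p q) (addP r s) ≈ addP (addP p r) (addP q s)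
addP-interchange p q r s = coeffwise λ k → begin
  coeff (addP (addP p q) (addP r s)) k
    ≡⟨ trans (coeff-addP (addP p q) _ k) (cong₂ ℤ._+_ (coeff-addP p q k) (coeff-addP r s k)) ⟩
  (coeff p k ℤ.+ coeff q k) ℤ.+ (coeff r k ℤ.+ coeff s k)
    ≡⟨ ℤ-+-interchange (coeff p k) _ _ _ ⟩
  (coeff p k ℤ.+ coeff r k) ℤ.+ (coeff q k ℤ.+ coeff s k)
    ≡⟨ trans (coeff-addP (addP p r) _ k) (cong₂ ℤ._+_ (coeff-addP p r k) (coeff-addP q s k)) ⟨
  coeff (addP (addP p r) (addP q s)) k
    ∎
  where open ≡-Reasoning

scaleP-addP : ∀ c p q → scaleP c (addP p q) ≈ addP (scaleP c p) (scaleP c q)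
scaleP-addP c p q = coeffwise λ k → begin
  coeff (scaleP c (addP p q)) k             ≡⟨ trans (coeff-scaleP c (addP p q) k) (cong (c ℤ.*_) (coeff-addP p q k)) ⟩
  c ℤ.* (coeff p k ℤ.+ coeff q k)           ≡⟨ ℤ.*-distribˡ-+ c (coeff p k) _ ⟩
  c ℤ.* coeff p k ℤ.+ c ℤ.* coeff q k       ≡⟨ trans (coeff-addP (scaleP c p) _ k)
                                                     (cong₂ ℤ._+_ (coeff-scaleP c p k) (coeff-scaleP c q k)) ⟨
  coeff (addP (scaleP c p) (scaleP c q)) k  ∎
  where open ≡-Reasoning

scaleP-+ : ∀ a b p → scaleP (a ℤ.+ b) p ≈ addP (scaleP a p) (scaleP b p)
scaleP-+ a b p = coeffwise λ k → begin
  coeff (scaleP (a ℤ.+ b) p) k              ≡⟨ coeff-scaleP (a ℤ.+ b) p k ⟩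
  (a ℤ.+ b) ℤ.* coeff p k                   ≡⟨ ℤ.*-distribʳ-+ (coeff p k) a b ⟩
  a ℤ.* coeff p k ℤ.+ b ℤ.* coeff p k       ≡⟨ trans (coeff-addP (scaleP a p) _ k)
                                                     (cong₂ ℤ._+_ (coeff-scaleP a p k) (coeff-scaleP b p k)) ⟨
  coeff (addP (scaleP a p) (scaleP b p)) k  ∎
  where open ≡-Reasoning

scaleP-* : ∀ a b p → scaleP a (scaleP b p) ≈ scaleP (a ℤ.* b) p
scaleP-* a b p = coeffwise λ k → begin
  coeff (scaleP a (scaleP b p)) k  ≡⟨ trans (coeff-scaleP a (scaleP b p) k) (cong (a ℤ.*_) (coeff-scaleP b p k)) ⟩
  a ℤ.* (b ℤ.* coeff p k)          ≡⟨ ℤ.*-assoc a b _ ⟨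
  a ℤ.* b ℤ.* coeff p k            ≡⟨ coeff-scaleP (a ℤ.* b) p k ⟨
  coeff (scaleP (a ℤ.* b) p) k     ∎
  where open ≡-Reasoning

scaleP-t· : ∀ c p → scaleP c (t· p) ≈ t· scaleP c p
scaleP-t· c p = coeffwise λ { zero → ℤ.*-zeroʳ c ; (suc k) → refl }

scaleP-zero : ∀ p → scaleP (+ 0) p ≈ []
scaleP-zero p = coeffwise λ k → trans (coeff-scaleP (+ 0) p k) (ℤ.*-zeroˡ (coeff p k))

scaleP-identity : ∀ p → scaleP (+ 1) p ≈ p
scaleP-identity p = coeffwise λ k → trans (coeff-scaleP (+ 1) p k) (ℤ.*-identityˡ (coeff p k))

mulP-zeroʳ : ∀ p → mulP p [] ≈ []
mulP-zeroʳ []      = ≈-refl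
mulP-zeroʳ (a ∷ p) = ≈-trans (t·-cong (mulP-zeroʳ p)) t·[]≈[]

mulP-identityˡ : ∀ q → mulP (+ 1 ∷ []) q ≈ q
mulP-identityˡ q = ≈-trans (addP-cong (scaleP-identity q) t·[]≈[]) (addP-identityʳ q)

mulP-distribˡ : ∀ p q r → mulP p (addP q r) ≈ addP (mulP p q) (mulP p r)
mulP-distribˡ []      q r = ≈-refl
mulP-distribˡ (a ∷ p) q r = begin
  addP (scaleP a (addP q r)) (t· mulP p (addP q r))
    ≈⟨ addP-cong (scaleP-addP a q r) (t·-cong (mulP-distribˡ p q r)) ⟩
  addP (addP (scaleP a q) (scaleP a r)) (addP (t· mulP p q) (t· mulP p r))
    ≈⟨ addP-interchange (scaleP a q) _ _ _ ⟩
  addP (mulP (a ∷ p) q) (mulP (a ∷ p) r)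
    ∎
  where open ≈-Reasoning

mulP-distribʳ : ∀ p p′ q → mulP (addP p p′) q ≈ addP (mulP p q) (mulP p′ q)
mulP-distribʳ []      p′       q = ≈-refl
mulP-distribʳ (a ∷ p) []       q = ≈-sym (addP-identityʳ _)
mulP-distribʳ (a ∷ p) (b ∷ p′) q = begin
  addP (scaleP (a ℤ.+ b) q) (t· mulP (addP p p′) q)
    ≈⟨ addP-cong (scaleP-+ a b q) (t·-cong (mulP-distribʳ p p′ q)) ⟩
  addP (addP (scaleP a q) (scaleP b q)) (addP (t· mulP p q) (t· mulP p′ q))
    ≈⟨ addP-interchange (scaleP a q) _ _ _ ⟩
  addP (mulP (a ∷ p) q) (mulP (b ∷ p′) q)
    ∎
  where open ≈-Reasoning

mulP-t·ʳ : ∀ p q → mulP p (t· q) ≈ t· mulP p q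
mulP-t·ʳ []      q = ≈-sym t·[]≈[]
mulP-t·ʳ (a ∷ p) q = begin
  addP (scaleP a (t· q)) (t· mulP p (t· q))
    ≈⟨ addP-cong (scaleP-t· a q) (t·-cong (mulP-t·ʳ p q)) ⟩
  t· addP (scaleP a q) (t· mulP p q)
    ∎
  where open ≈-Reasoning

mulP-scalePˡ : ∀ c p q → mulP (scaleP c p) q ≈ scaleP c (mulP p q)
mulP-scalePˡ c []      q = ≈-refl
mulP-scalePˡ c (a ∷ p) q = begin
  addP (scaleP (c ℤ.* a) q) (t· mulP (scaleP c p) q)
    ≈⟨ addP-cong (≈-sym (scaleP-* c a q)) (t·-cong (mulP-scalePˡ c p q)) ⟩
  addP (scaleP c (scaleP a q)) (t· scaleP c (mulP p q))
    ≈⟨ addP-congʳ (scaleP c (scaleP a q)) (scaleP-t· c (mulP p q)) ⟨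
  addP (scaleP c (scaleP a q)) (scaleP c (t· mulP p q))
    ≈⟨ scaleP-addP c (scaleP a q) _ ⟨
  scaleP c (mulP (a ∷ p) q)
    ∎
  where open ≈-Reasoning

mulP-t·ˡ : ∀ p q → mulP (t· p) q ≈ t· mulP p q
mulP-t·ˡ p q = addP-cong (scaleP-zero q) (≈-refl {t· mulP p q})

mulP-assoc : ∀ p q r → mulP (mulP p q) r ≈ mulP p (mulP q r)
mulP-assoc []      q r = ≈-refl
mulP-assoc (a ∷ p) q r = begin
  mulP (addP (scaleP a q) (t· mulP p q)) r
    ≈⟨ mulP-distribʳ (scaleP a q) _ r ⟩
  addP (mulP (scaleP a q) r) (mulP (t· mulP p q) r)
    ≈⟨ addP-cong (mulP-scalePˡ a q r) (≈-trans (mulP-t·ˡ (mulP p q) r) (t·-cong (mulP-assoc p q r))) ⟩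
  mulP (a ∷ p) (mulP q r)
    ∎
  where open ≈-Reasoning

mulP-onePlusT : ∀ p → mulP onePlusT p ≈ addP p (t· p)
mulP-onePlusT p = addP-cong (scaleP-identity p) (t·-cong (mulP-identityˡ p))

-- Divisibility by powers of 1 + t

record [1+t]^_∣_ (k : ℕ) (p : Poly) : Set where
  constructor divides
  field
    quotient : Poly
    equation : p ≈ mulP (powP onePlusT k) quotient

∣⇒∣P : ∀ {k p} → [1+t]^ k ∣ p → powP onePlusT k ∣P p
∣⇒∣P (divides q p≈) = q , coeff-≡ p≈

∣-resp-≈ : ∀ {k p p′} → p ≈ p′ → [1+t]^ k ∣ p → [1+t]^ k ∣ p′
∣-resp-≈ p≈p′ (divides q p≈) = divides q (≈-trans (≈-sym p≈p′) p≈)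

[1+t]^0∣ : ∀ p → [1+t]^ 0 ∣ p
[1+t]^0∣ p = divides p (≈-sym (mulP-identityˡ p))

∣[] : ∀ k → [1+t]^ k ∣ []
∣[] k = divides [] (≈-sym (mulP-zeroʳ (powP onePlusT k)))

∣-addP : ∀ {k p p′} → [1+t]^ k ∣ p → [1+t]^ k ∣ p′ → [1+t]^ k ∣ addP p p′
∣-addP {k} (divides q p≈) (divides q′ p′≈) =
  divides (addP q q′) (≈-trans (addP-cong p≈ p′≈) (≈-sym (mulP-distribˡ (powP onePlusT k) q q′)))

∣-t^ : ∀ {k p} b → [1+t]^ k ∣ p → [1+t]^ k ∣ t^[ b ] p
∣-t^ {k} true  (divides q p≈) = divides (t· q) (≈-trans (t·-cong p≈) (≈-sym (mulP-t·ʳ (powP onePlusT k) q)))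
∣-t^     false p∣             = p∣

∣-addP-t· : ∀ {k p} → [1+t]^ k ∣ p → [1+t]^ suc k ∣ addP p (t· p)
∣-addP-t· {k} {p} (divides q p≈) = divides q (begin
  addP p (t· p)                                    ≈⟨ addP-cong p≈ (t·-cong p≈) ⟩
  addP (mulP P q) (t· mulP P q)                    ≈⟨ mulP-onePlusT (mulP P q) ⟨
  mulP onePlusT (mulP P q)                         ≈⟨ mulP-assoc onePlusT P q ⟨
  mulP (powP onePlusT (suc k)) q                   ∎)
  where
  P = powP onePlusT k
  open ≈-Reasoning

-- u xor true and u xor false are complementary, so this is p + t p in some order.
∣-t^-xor-pair : ∀ {k p} u → [1+t]^ k ∣ p → [1+t]^ suc k ∣ addP (t^[ u xor true ] p) (t^[ u xor false ] p)
∣-t^-xor-pair         true  p∣ = ∣-addP-t· p∣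
∣-t^-xor-pair {p = p} false p∣ = ∣-resp-≈ (addP-comm p (t· p)) (∣-addP-t· p∣)

sumP : {A : Set} → (A → Poly) → List A → Poly
sumP f = foldr (λ x → addP (f x)) []

module _ {A : Set} where

  sumP-cong : ∀ {f g : A → Poly} xs → All (λ x → f x ≈ g x) xs → sumP f xs ≈ sumP g xs
  sumP-cong []       []           = ≈-refl
  sumP-cong (x ∷ xs) (fx≈gx ∷ eq) = addP-cong fx≈gx (sumP-cong xs eq)

  sumP-++ : ∀ (f : A → Poly) xs ys → sumP f (xs ++ ys) ≈ addP (sumP f xs) (sumP f ys)
  sumP-++ f []       ys = ≈-refl
  sumP-++ f (x ∷ xs) ys = ≈-trans (addP-congʳ (f x) (sumP-++ f xs ys)) (≈-sym (addP-assoc (f x) _ _))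

  sumP-addP : ∀ (f g : A → Poly) xs → sumP (λ x → addP (f x) (g x)) xs ≈ addP (sumP f xs) (sumP g xs)
  sumP-addP f g []       = ≈-refl
  sumP-addP f g (x ∷ xs) = ≈-trans (addP-congʳ (addP (f x) (g x)) (sumP-addP f g xs)) (addP-interchange (f x) (g x) _ _)

  sumP-t^ : ∀ b (f : A → Poly) xs → sumP (λ x → t^[ b ] f x) xs ≈ t^[ b ] sumP f xs
  sumP-t^ true  f []       = ≈-sym t·[]≈[]
  sumP-t^ false f []       = ≈-refl
  sumP-t^ b     f (x ∷ xs) = ≈-trans (addP-congʳ (t^[ b ] f x) (sumP-t^ b f xs)) (≈-reflexive (sym (t^-addP b (f x) _)))

  sumP-filter : ∀ {P : A → Set} (P? : ∀ x → Dec (P x)) (f : A → Poly) xs →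
                sumP f (filter P? xs) ≡ sumP (λ x → if does (P? x) then f x else []) xs
  sumP-filter P? f []       = refl
  sumP-filter P? f (x ∷ xs) with does (P? x)
  ... | true  = cong (addP (f x)) (sumP-filter P? f xs)
  ... | false = sumP-filter P? f xs

  ∣-sumP : ∀ {k} {f : A → Poly} {xs} → All (λ x → [1+t]^ k ∣ f x) xs → [1+t]^ k ∣ sumP f xs
  ∣-sumP {k} []         = ∣[] k
  ∣-sumP     (fx∣ ∷ f∣) = ∣-addP fx∣ (∣-sumP f∣)

sumP-map : ∀ {A B : Set} (f : B → Poly) (g : A → B) xs → sumP f (map g xs) ≡ sumP (f ∘ g) xs
sumP-map f g []       = refl
sumP-map f g (x ∷ xs) = cong (addP (f (g x))) (sumP-map f g xs)

sumP-concatMap : ∀ {A B : Set} (f : B → Poly) (h : A → List B) xs →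
                 sumP f (concatMap h xs) ≈ sumP (λ x → sumP f (h x)) xs
sumP-concatMap f h []       = ≈-refl
sumP-concatMap f h (x ∷ xs) = ≈-trans (sumP-++ f (h x) (concatMap h xs)) (addP-congʳ (sumP f (h x)) (sumP-concatMap f h xs))

module _ {A : Set} where

  listsOf-length : ∀ k (V : List A) → All (λ w → length w ≡ k) (listsOf k V)
  listsOf-length zero    V = refl ∷ []
  listsOf-length (suc k) V = concat⁺ (All.map⁺ (All.tabulate {xs = V} λ _ → All.map⁺ (All.map (cong suc) (listsOf-length k V))))

  sumP-listsOf-suc : ∀ (F : List A → Poly) k V →
                     sumP F (listsOf (suc k) V) ≈ sumP (λ v → sumP (F ∘ (v ∷_)) (listsOf k V)) V
  sumP-listsOf-suc F k V = ≈-trans (sumP-concatMap F (λ v → map (v ∷_) (listsOf k V)) V)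
                                   (sumP-cong V (All.tabulate λ {v} _ → ≈-reflexive (sumP-map F (v ∷_) (listsOf k V))))

bools : List Bool
bools = true ∷ false ∷ []

sumP-listsOf-bools : ∀ (F : List Bool → Poly) k →
  sumP F (listsOf (suc k) bools) ≈ addP (sumP (F ∘ (true ∷_)) (listsOf k bools)) (sumP (F ∘ (false ∷_)) (listsOf k bools))
sumP-listsOf-bools F k =
  ≈-trans (sumP-listsOf-suc F k bools) (addP-congʳ (sumP (F ∘ (true ∷_)) (listsOf k bools)) (addP-identityʳ _))

signedVal : ℕ → Bool → ℤ
signedVal i true  = + suc i
signedVal i false = -[1+ i ]

map-applyUpTo : ∀ {A B : Set} (f : A → B) (g : ℕ → A) n → map f (applyUpTo g n) ≡ applyUpTo (f ∘ g) n
map-applyUpTo f g zero    = refl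
map-applyUpTo f g (suc n) = cong (f (g 0) ∷_) (map-applyUpTo f (g ∘ suc) n)

sumP-applyUpTo : ∀ {A : Set} (G : A → Poly) (f : ℕ → A) n → sumP G (applyUpTo f n) ≡ sumP (G ∘ f) (upTo n)
sumP-applyUpTo G f n = trans (cong (sumP G) (sym (map-applyUpTo f (λ i → i) n))) (sumP-map G f (upTo n))

sumP-signedVals : ∀ n (G : ℤ → Poly) →
  sumP G (signedVals n) ≈ sumP (λ i → addP (G (signedVal i true)) (G (signedVal i false))) (upTo n)
sumP-signedVals n G = begin
  sumP G (applyUpTo (λ i → signedVal i true) n ++ applyUpTo (λ i → signedVal i false) n)
    ≈⟨ sumP-++ G (applyUpTo (λ i → signedVal i true) n) _ ⟩
  addP (sumP G (applyUpTo (λ i → signedVal i true) n)) (sumP G (applyUpTo (λ i → signedVal i false) n))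
    ≡⟨ cong₂ addP (sumP-applyUpTo G (λ i → signedVal i true) n) (sumP-applyUpTo G (λ i → signedVal i false) n) ⟩
  addP (sumP (λ i → G (signedVal i true)) (upTo n)) (sumP (λ i → G (signedVal i false)) (upTo n))
    ≈⟨ sumP-addP (λ i → G (signedVal i true)) (λ i → G (signedVal i false)) (upTo n) ⟨
  sumP (λ i → addP (G (signedVal i true)) (G (signedVal i false))) (upTo n)
    ∎
  where open ≈-Reasoning

-- A word over ±1, …, ±n is a word over 1, …, n (stored shifted down by one) together with a sign word.
sumP-listsOf-signedVals : ∀ n k (F : List ℤ → Poly) →
  sumP F (listsOf k (signedVals n))
    ≈ sumP (λ a → sumP (λ e → F (zipWith signedVal a e)) (listsOf k bools)) (listsOf k (upTo n))
sumP-listsOf-signedVals n zero    F = addP-cong (≈-sym (addP-identityʳ (F []))) ≈-refl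
sumP-listsOf-signedVals n (suc k) F = begin
  sumP F (listsOf (suc k) (signedVals n))
    ≈⟨ sumP-listsOf-suc F k (signedVals n) ⟩
  sumP X (signedVals n)
    ≈⟨ sumP-signedVals n X ⟩
  sumP (λ i → addP (X (signedVal i true)) (X (signedVal i false))) (upTo n)
    ≈⟨ sumP-cong (upTo n) (All.tabulate λ {i} _ → first-letter i) ⟨
  sumP (λ i → sumP (Y ∘ (i ∷_)) (listsOf k (upTo n))) (upTo n)
    ≈⟨ sumP-listsOf-suc Y k (upTo n) ⟨
  sumP Y (listsOf (suc k) (upTo n))
    ∎
  where
  open ≈-Reasoning
  X : ℤ → Poly
  X v = sumP (F ∘ (v ∷_)) (listsOf k (signedVals n))
  Y : List ℕ → Poly
  Y a = sumP (λ e → F (zipWith signedVal a e)) (listsOf (suc k) bools)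
  Z : ℕ → Bool → List ℕ → Poly
  Z i b a = sumP (λ e → F (signedVal i b ∷ zipWith signedVal a e)) (listsOf k bools)
  first-letter : ∀ i → sumP (Y ∘ (i ∷_)) (listsOf k (upTo n)) ≈ addP (X (signedVal i true)) (X (signedVal i false))
  first-letter i = begin
    sumP (Y ∘ (i ∷_)) (listsOf k (upTo n))
      ≈⟨ sumP-cong (listsOf k (upTo n))
           (All.tabulate λ {a} _ → sumP-listsOf-bools (λ e → F (zipWith signedVal (i ∷ a) e)) k) ⟩
    sumP (λ a → addP (Z i true a) (Z i false a)) (listsOf k (upTo n))
      ≈⟨ sumP-addP (Z i true) (Z i false) (listsOf k (upTo n)) ⟩
    addP (sumP (Z i true) (listsOf k (upTo n))) (sumP (Z i false) (listsOf k (upTo n)))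
      ≈⟨ addP-cong (sumP-listsOf-signedVals n k (F ∘ (signedVal i true ∷_)))
                   (sumP-listsOf-signedVals n k (F ∘ (signedVal i false ∷_))) ⟨
    addP (X (signedVal i true)) (X (signedVal i false))
      ∎

∣signedVal∣ : ∀ i b → ∣ signedVal i b ∣ ≡ suc i
∣signedVal∣ i true  = refl
∣signedVal∣ i false = refl

map-∣∣-zipWith-signedVal : ∀ a e → length e ≡ length a → map ∣_∣ (zipWith signedVal a e) ≡ map suc a
map-∣∣-zipWith-signedVal []      []      _   = refl
map-∣∣-zipWith-signedVal (i ∷ a) (b ∷ e) len =
  cong₂ _∷_ (∣signedVal∣ i b) (map-∣∣-zipWith-signedVal a e (ℕ.suc-injective len))

signedVal-≢ : ∀ {i j} b b′ → i ≢ j → signedVal i b ≢ signedVal j b′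
signedVal-≢ {i} {j} b b′ i≢j eq =
  i≢j (ℕ.suc-injective (trans (sym (∣signedVal∣ i b)) (trans (cong ∣_∣ eq) (∣signedVal∣ j b′))))

0≢signedVal : ∀ i b → + 0 ≢ signedVal i b
0≢signedVal i b eq = ℕ.0≢1+n (trans (cong ∣_∣ eq) (∣signedVal∣ i b))

memℕ-suc : ∀ x ys → memℕ (suc x) (map suc ys) ≡ memℕ x ys
memℕ-suc x []       = refl
memℕ-suc x (y ∷ ys) = cong (does (x ℕ.≟ y) ∨_) (memℕ-suc x ys)

distinct-map-suc : ∀ xs → distinct (map suc xs) ≡ distinct xs
distinct-map-suc []       = refl
distinct-map-suc (x ∷ xs) = cong₂ (λ m d → not m ∧ d) (memℕ-suc x xs) (distinct-map-suc xs)

memℕ≡false⇒All≢ : ∀ {x} ys → memℕ x ys ≡ false → All (x ≢_) ys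
memℕ≡false⇒All≢     []       _  = []
memℕ≡false⇒All≢ {x} (y ∷ ys) x∉ =
  (λ x≡y → subst T (∨-conicalˡ _ _ x∉) (ℕ.≡⇒≡ᵇ x y x≡y)) ∷ memℕ≡false⇒All≢ ys (∨-conicalʳ _ _ x∉)

distinct⇒AllPairs≢ : ∀ xs → distinct xs ≡ true → AllPairs _≢_ xs
distinct⇒AllPairs≢ []       _ = []
distinct⇒AllPairs≢ (x ∷ xs) d =
  memℕ≡false⇒All≢ xs (not-injective (∧-conicalˡ _ _ d)) ∷ distinct⇒AllPairs≢ xs (∧-conicalʳ _ _ d)

-- The parity of inv_B

odd : ℕ → Bool
odd zero    = false
odd (suc n) = not (odd n)

isEven≡not-odd : ∀ n → isEven n ≡ not (odd n)
isEven≡not-odd zero          = refl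
isEven≡not-odd (suc zero)    = refl
isEven≡not-odd (suc (suc n)) = trans (isEven≡not-odd n) (sym (not-involutive (not (odd n))))

odd-+ : ∀ m n → odd (m ℕ.+ n) ≡ odd m xor odd n
odd-+ zero    n = refl
odd-+ (suc m) n = trans (cong not (odd-+ m n)) (not-distribˡ-xor (odd m) (odd n))

odd-indicator : ∀ b → odd (if b then 1 else 0) ≡ b
odd-indicator true  = refl
odd-indicator false = refl

odd-count-∷ : ∀ {A : Set} (p : A → Bool) x xs → odd (count p (x ∷ xs)) ≡ p x xor odd (count p xs)
odd-count-∷ p x xs = trans (odd-+ (if p x then 1 else 0) _) (cong (_xor odd (count p xs)) (odd-indicator (p x)))

<ᵇ-flipℕ : ∀ {i j} → i ≢ j → (j ℕ.<ᵇ i) ≡ not (i ℕ.<ᵇ j)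
<ᵇ-flipℕ {zero}  {zero}  i≢j = ⊥-elim (i≢j refl)
<ᵇ-flipℕ {zero}  {suc j} i≢j = refl
<ᵇ-flipℕ {suc i} {zero}  i≢j = refl
<ᵇ-flipℕ {suc i} {suc j} i≢j = <ᵇ-flipℕ (i≢j ∘ cong suc)

inversions : List ℕ → ℕ
inversions []      = 0
inversions (i ∷ a) = count (ℕ._<ᵇ i) a ℕ.+ inversions a

negatives : List Bool → ℕ
negatives = count not

-- The pair {i, j} contributes 1 + [i < j] or [j < i] to inv_B, according to the sign of π_j.
signedVal-pair-parity : ∀ {i j} b b′ → i ≢ j →
  (signedVal i b >ᵇ signedVal j b′) xor ((ℤ.- signedVal i b) >ᵇ signedVal j b′) ≡ (j ℕ.<ᵇ i)
signedVal-pair-parity true  true  i≢j = xor-identityʳ _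
signedVal-pair-parity false true  i≢j = refl
signedVal-pair-parity true  false i≢j = sym (<ᵇ-flipℕ i≢j)
signedVal-pair-parity false false i≢j = trans (xor-comm _ true) (sym (<ᵇ-flipℕ i≢j))

signedVal-<0 : ∀ i b → (signedVal i b <ᵇ (+ 0)) ≡ not b
signedVal-<0 i true  = refl
signedVal-<0 i false = refl

odd-pairs-with-first : ∀ {i} b as e → All (i ≢_) as → length e ≡ length as →
  odd (count (signedVal i b >ᵇ_) (zipWith signedVal as e)) xor odd (count ((ℤ.- signedVal i b) >ᵇ_) (zipWith signedVal as e))
    ≡ odd (count (ℕ._<ᵇ i) as)
odd-pairs-with-first b []       []        []           _   = refl
odd-pairs-with-first {i} b (j ∷ as) (b′ ∷ e) (i≢j ∷ i≢as) len = begin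
  odd (count (s >ᵇ_) (signedVal j b′ ∷ w)) xor odd (count ((ℤ.- s) >ᵇ_) (signedVal j b′ ∷ w))
    ≡⟨ cong₂ _xor_ (odd-count-∷ (s >ᵇ_) (signedVal j b′) w) (odd-count-∷ ((ℤ.- s) >ᵇ_) (signedVal j b′) w) ⟩
  (P xor odd (count (s >ᵇ_) w)) xor (N xor odd (count ((ℤ.- s) >ᵇ_) w))
    ≡⟨ xor-interchange P _ N _ ⟩
  (P xor N) xor (odd (count (s >ᵇ_) w) xor odd (count ((ℤ.- s) >ᵇ_) w))
    ≡⟨ cong₂ _xor_ (signedVal-pair-parity b b′ i≢j) (odd-pairs-with-first b as e i≢as (ℕ.suc-injective len)) ⟩
  (j ℕ.<ᵇ i) xor odd (count (ℕ._<ᵇ i) as)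
    ≡⟨ odd-count-∷ (ℕ._<ᵇ i) j as ⟨
  odd (count (ℕ._<ᵇ i) (j ∷ as))
    ∎
  where
  open ≡-Reasoning
  s = signedVal i b
  w = zipWith signedVal as e
  P = s >ᵇ signedVal j b′
  N = (ℤ.- s) >ᵇ signedVal j b′

odd-invB-zipWith-signedVal : ∀ a e → AllPairs _≢_ a → length e ≡ length a →
  odd (invB (zipWith signedVal a e)) ≡ odd (inversions a) xor odd (negatives e)
odd-invB-zipWith-signedVal []      []      []              _   = refl
odd-invB-zipWith-signedVal (i ∷ a) (b ∷ e) (i≢a ∷ a-distinct) len = begin
  odd (C₁ ℕ.+ C₂ ℕ.+ Neg ℕ.+ invB w)
    ≡⟨ trans (odd-+ (C₁ ℕ.+ C₂ ℕ.+ Neg) _)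
             (cong (_xor odd (invB w)) (trans (odd-+ (C₁ ℕ.+ C₂) _) (cong (_xor odd Neg) (odd-+ C₁ _)))) ⟩
  ((odd C₁ xor odd C₂) xor odd Neg) xor odd (invB w)
    ≡⟨ cong₂ (λ x y → (x xor odd Neg) xor y)
             (odd-pairs-with-first b a e i≢a len′) (odd-invB-zipWith-signedVal a e a-distinct len′) ⟩
  (odd K xor odd Neg) xor (odd (inversions a) xor odd (negatives e))
    ≡⟨ cong (λ x → (odd K xor x) xor (odd (inversions a) xor odd (negatives e))) (trans (odd-indicator _) (signedVal-<0 i b)) ⟩
  (odd K xor not b) xor (odd (inversions a) xor odd (negatives e))
    ≡⟨ xor-interchange (odd K) (not b) _ _ ⟩
  (odd K xor odd (inversions a)) xor (not b xor odd (negatives e))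
    ≡⟨ cong₂ _xor_ (odd-+ K (inversions a)) (odd-count-∷ not b e) ⟨
  odd (inversions (i ∷ a)) xor odd (negatives (b ∷ e))
    ∎
  where
  open ≡-Reasoning
  w = zipWith signedVal a e
  len′ = ℕ.suc-injective len
  C₁ = count (signedVal i b >ᵇ_) w
  C₂ = count ((ℤ.- signedVal i b) >ᵇ_) w
  Neg = if signedVal i b <ᵇ (+ 0) then 1 else 0
  K = count (ℕ._<ᵇ i) a

-- Alternating runs

ascents : List ℤ → List Bool
ascents (x ∷ y ∷ w) = (x <ᵇ y) ∷ ascents (y ∷ w)
ascents _           = []

changes : List Bool → ℕ
changes (u ∷ v ∷ us) = (if u xor v then 1 else 0) ℕ.+ changes (v ∷ us)
changes _            = 0

<ᵇ-flip : ∀ {x y} → x ≢ y → (y <ᵇ x) ≡ not (x <ᵇ y)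
<ᵇ-flip {x} {y} x≢y with ℤ.<-cmp x y
... | tri< x<y _ y≮x = trans (dec-false (y ℤ.<? x) y≮x) (cong not (sym (dec-true (x ℤ.<? y) x<y)))
... | tri≈ _ x≡y _   = ⊥-elim (x≢y x≡y)
... | tri> x≮y _ y<x = trans (dec-true (y ℤ.<? x) y<x) (cong not (sym (dec-false (x ℤ.<? y) x≮y)))

turn-indicator : ∀ u v → (if u ∧ not v then 1 else 0) ℕ.+ (if not u ∧ v then 1 else 0) ≡ (if u xor v then 1 else 0)
turn-indicator true  true  = refl
turn-indicator true  false = refl
turn-indicator false true  = refl
turn-indicator false false = refl

peaks+valleys≡changes : ∀ {w} → Linked _≢_ w → pkTriples w ℕ.+ valTriples w ≡ changes (ascents w)
peaks+valleys≡changes []              = refl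
peaks+valleys≡changes [-]             = refl
peaks+valleys≡changes (_ ∷ [-])       = refl
peaks+valleys≡changes {x ∷ y ∷ z ∷ w} (x≢y ∷ y≢z ∷ l) = begin
  (Pk ℕ.+ pkTriples (y ∷ z ∷ w)) ℕ.+ (Val ℕ.+ valTriples (y ∷ z ∷ w))
    ≡⟨ ℕ-+-interchange Pk _ Val _ ⟩
  (Pk ℕ.+ Val) ℕ.+ (pkTriples (y ∷ z ∷ w) ℕ.+ valTriples (y ∷ z ∷ w))
    ≡⟨ cong₂ ℕ._+_ turn (peaks+valleys≡changes (y≢z ∷ l)) ⟩
  (if (x <ᵇ y) xor (y <ᵇ z) then 1 else 0) ℕ.+ changes (ascents (y ∷ z ∷ w))
    ∎
  where
  open ≡-Reasoning
  Pk  = if (x <ᵇ y) ∧ (y >ᵇ z) then 1 else 0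
  Val = if (x >ᵇ y) ∧ (y <ᵇ z) then 1 else 0
  turn : Pk ℕ.+ Val ≡ (if (x <ᵇ y) xor (y <ᵇ z) then 1 else 0)
  turn rewrite <ᵇ-flip x≢y | <ᵇ-flip y≢z = turn-indicator (x <ᵇ y) (y <ᵇ z)

altrunsB≡1+changes : ∀ {w} → Linked _≢_ (+ 0 ∷ w) → altrunsB w ≡ suc (changes (ascents (+ 0 ∷ w)))
altrunsB≡1+changes {w} l = trans (ℕ.+-comm (pkB w ℕ.+ valB w) 1) (cong suc (peaks+valleys≡changes l))

ascentBit : Bool → Bool → Bool → Bool
ascentBit smaller s b = if smaller then b else not s

signedVal-<ᵇ : ∀ {i j} b b′ → i ≢ j → (signedVal i b <ᵇ signedVal j b′) ≡ ascentBit (i ℕ.<ᵇ j) b b′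
signedVal-<ᵇ {i} {j} true  true  _   with i ℕ.<ᵇ j
... | true  = refl
... | false = refl
signedVal-<ᵇ {i} {j} true  false _   = sym (if-eta (i ℕ.<ᵇ j))
signedVal-<ᵇ {i} {j} false true  _   = sym (if-eta (i ℕ.<ᵇ j))
signedVal-<ᵇ {i} {j} false false i≢j with i ℕ.<ᵇ j | <ᵇ-flipℕ i≢j
... | true  | j<i = j<i
... | false | j<i = j<i

ascentBits : ℕ → Bool → List ℕ → List Bool → List Bool
ascentBits i s (j ∷ as) (b ∷ e) = ascentBit (i ℕ.<ᵇ j) s b ∷ ascentBits j b as e
ascentBits _ _ _        _       = []

ascents-zipWith-signedVal : ∀ {i as} b e → Linked _≢_ (i ∷ as) →
  ascents (signedVal i b ∷ zipWith signedVal as e) ≡ ascentBits i b as e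
ascents-zipWith-signedVal {as = []}     b e       _             = refl
ascents-zipWith-signedVal {as = j ∷ as} b []      _             = refl
ascents-zipWith-signedVal {as = j ∷ as} b (b′ ∷ e) (i≢j ∷ l) =
  cong₂ _∷_ (signedVal-<ᵇ b b′ i≢j) (ascents-zipWith-signedVal b′ e l)

zipWith-signedVal-linked : ∀ {i as} b e → Linked _≢_ (i ∷ as) → Linked _≢_ (signedVal i b ∷ zipWith signedVal as e)
zipWith-signedVal-linked {as = []}     b e        _         = [-]
zipWith-signedVal-linked {as = j ∷ as} b []       _         = [-]
zipWith-signedVal-linked {as = j ∷ as} b (b′ ∷ e) (i≢j ∷ l) = signedVal-≢ b b′ i≢j ∷ zipWith-signedVal-linked b′ e l

-- Sums over sign words

select : Bool → Poly → Poly
select b p = if b then p else []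

select-t^ : ∀ c b p → select c (t^[ b ] p) ≈ t^[ b ] select c p
select-t^ true  b     p = ≈-refl
select-t^ false true  p = ≈-sym t·[]≈[]
select-t^ false false p = ≈-refl

monomial-indicator : ∀ b k → monomial ((if b then 1 else 0) ℕ.+ k) ≡ t^[ b ] monomial k
monomial-indicator true  k = refl
monomial-indicator false k = refl

-- signSum i s u c as sums t^(number of changes) over the sign words e for the letters as, continuing a
-- word that ends in signedVal i s, reached by an ascent iff u; e is counted iff odd (negatives e) xor c.
mutual
  signSum : ℕ → Bool → Bool → Bool → List ℕ → Poly
  signSum _ _ _ c []       = select c (monomial 0)
  signSum i s u c (j ∷ as) = signSumStep (i ℕ.<ᵇ j) s u c j as

  signSumStep : Bool → Bool → Bool → Bool → ℕ → List ℕ → Poly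
  signSumStep smaller s u c j as =
    addP (t^[ u xor ascentBit smaller s true ]  signSum j true  (ascentBit smaller s true)  c       as)
         (t^[ u xor ascentBit smaller s false ] signSum j false (ascentBit smaller s false) (not c) as)

sumP-signSum : ∀ as i s u c →
  sumP (λ e → select (odd (negatives e) xor c) (monomial (changes (u ∷ ascentBits i s as e)))) (listsOf (length as) bools)
    ≈ signSum i s u c as
sumP-signSum []       i s u c = addP-identityʳ _
sumP-signSum (j ∷ as) i s u c = begin
  sumP F (listsOf (suc (length as)) bools)
    ≈⟨ sumP-listsOf-bools F (length as) ⟩
  addP (sumP (F ∘ (true ∷_)) (listsOf (length as) bools)) (sumP (F ∘ (false ∷_)) (listsOf (length as) bools))
    ≈⟨ addP-cong (branch true c)
                 (sumP-cong (listsOf (length as) bools) (All.tabulate λ {e} _ → ≈-reflexive (negative-flips e))) ⟩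
  addP (t^[ u xor A true ] signSum j true (A true) c as) (sumP (G false (not c)) (listsOf (length as) bools))
    ≈⟨ addP-congʳ (t^[ u xor A true ] signSum j true (A true) c as) (branch false (not c)) ⟩
  signSumStep (i ℕ.<ᵇ j) s u c j as
    ∎
  where
  open ≈-Reasoning
  A = ascentBit (i ℕ.<ᵇ j) s
  F : List Bool → Poly
  F e = select (odd (negatives e) xor c) (monomial (changes (u ∷ ascentBits i s (j ∷ as) e)))
  G : Bool → Bool → List Bool → Poly
  G b c′ e = select (odd (negatives e) xor c′) (monomial (changes (u ∷ A b ∷ ascentBits j b as e)))
  negative-flips : ∀ e → F (false ∷ e) ≡ G false (not c) e
  negative-flips e = cong (λ x → select x _)
    (trans (sym (not-distribˡ-xor (odd (negatives e)) c)) (not-distribʳ-xor (odd (negatives e)) c))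
  branch : ∀ b c′ → sumP (G b c′) (listsOf (length as) bools) ≈ t^[ u xor A b ] signSum j b (A b) c′ as
  branch b c′ = begin
    sumP (G b c′) (listsOf (length as) bools)
      ≈⟨ sumP-cong (listsOf (length as) bools) (All.tabulate λ {e} _ → first-change e) ⟩
    sumP (λ e → t^[ u xor A b ] H e) (listsOf (length as) bools)
      ≈⟨ sumP-t^ (u xor A b) H (listsOf (length as) bools) ⟩
    t^[ u xor A b ] sumP H (listsOf (length as) bools)
      ≈⟨ t^-cong (u xor A b) (sumP-signSum as j b (A b) c′) ⟩
    t^[ u xor A b ] signSum j b (A b) c′ as
      ∎
    where
    H : List Bool → Poly
    H e = select (odd (negatives e) xor c′) (monomial (changes (A b ∷ ascentBits j b as e)))
    first-change : ∀ e → G b c′ e ≈ t^[ u xor A b ] H e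
    first-change e = ≈-trans
      (≈-reflexive (cong (select (odd (negatives e) xor c′)) (monomial-indicator (u xor A b) (changes (A b ∷ ascentBits j b as e)))))
      (select-t^ (odd (negatives e) xor c′) (u xor A b) (monomial (changes (A b ∷ ascentBits j b as e))))

ascentBit-not : ∀ smaller s b → ascentBit smaller (not s) b ≡ not (ascentBit smaller s (not b))
ascentBit-not true  s true  = refl
ascentBit-not true  s false = refl
ascentBit-not false s true  = refl
ascentBit-not false s false = refl

-- Negating every sign negates every ascent bit, so the number of changes is unchanged, while the number
-- of negative letters among the remaining ones goes from m to length − m.
signSum-complement : ∀ as i s u c → signSum i (not s) (not u) c as ≈ signSum i s u (odd (length as) xor c) as
signSum-complement []       i s u c = ≈-refl
signSum-complement (j ∷ as) i s u c = complementStep (i ℕ.<ᵇ j)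
  where
  o = odd (length as)
  complementStep : ∀ x → signSumStep x (not s) (not u) c j as ≈ signSumStep x s u (not o xor c) j as
  complementStep x
    rewrite ascentBit-not x s true | ascentBit-not x s false
          | xor-annihilates-not u (ascentBit x s false) | xor-annihilates-not u (ascentBit x s true) =
    ≈-trans (addP-comm (t^[ u xor ascentBit x s false ] signSum j true (not (ascentBit x s false)) c as)
                       (t^[ u xor ascentBit x s true ] signSum j false (not (ascentBit x s true)) (not c) as))
      (addP-cong (t^-cong (u xor ascentBit x s true)
                   (≈-trans (signSum-complement as j true (ascentBit x s true) (not c))
                            (≈-reflexive (cong (λ c′ → signSum j true (ascentBit x s true) c′ as)
                                               (trans (sym (not-distribʳ-xor o c)) (not-distribˡ-xor o c))))))
                 (t^-cong (u xor ascentBit x s false)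
                   (≈-trans (signSum-complement as j false (ascentBit x s false) c)
                            (≈-reflexive (cong (λ c′ → signSum j false (ascentBit x s false) c′ as)
                                               (trans (sym (not-involutive (o xor c))) (cong not (not-distribˡ-xor o c))))))))

⌊1+n/2⌋≡⌊n/2⌋ : ∀ n → odd n ≡ false → ⌊ suc n /2⌋ ≡ ⌊ n /2⌋
⌊1+n/2⌋≡⌊n/2⌋ zero          _    = refl
⌊1+n/2⌋≡⌊n/2⌋ (suc (suc n)) even = cong suc (⌊1+n/2⌋≡⌊n/2⌋ n (trans (sym (not-involutive (odd n))) even))

⌊1+n/2⌋≡1+⌊n/2⌋ : ∀ n → odd n ≡ true → ⌊ suc n /2⌋ ≡ suc ⌊ n /2⌋
⌊1+n/2⌋≡1+⌊n/2⌋ (suc zero)    _   = refl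
⌊1+n/2⌋≡1+⌊n/2⌋ (suc (suc n)) odd = cong suc (⌊1+n/2⌋≡1+⌊n/2⌋ n (trans (sym (not-involutive _)) odd))

module _ (as : List ℕ) (as-even : odd (length as) ≡ false)
         (as∣ : ∀ k s u c → [1+t]^ ⌊ length as /2⌋ ∣ signSum k s u c as) where

  private
    complement-even : ∀ k s u c → signSum k (not s) (not u) c as ≈ signSum k s u c as
    complement-even k s u c =
      ≈-trans (signSum-complement as k s u c) (≈-reflexive (cong (λ o → signSum k s u (o xor c) as) as-even))

    complement-odd : ∀ j k s u c → signSum j (not s) (not u) c (k ∷ as) ≈ signSum j s u (not c) (k ∷ as)
    complement-odd j k s u c =
      ≈-trans (signSum-complement (k ∷ as) j s u c) (≈-reflexive (cong (λ o → signSum j s u (not o xor c) (k ∷ as)) as-even))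

  -- If j < k, the ascent into k is the sign of k, whatever the sign of j.
  sign-pair-ascent-∣ : ∀ k v c →
    [1+t]^ suc ⌊ length as /2⌋ ∣ addP (signSumStep true true v c k as) (signSumStep true false v (not c) k as)
  sign-pair-ascent-∣ k v c =
    ∣-resp-≈ (≈-sym rearranged) (∣-t^-xor-pair v (∣-addP (as∣ k true true c) (as∣ k true true (not c))))
    where
    open ≈-Reasoning
    Y : Bool → Poly
    Y c′ = signSum k true true c′ as
    rearranged : addP (signSumStep true true v c k as) (signSumStep true false v (not c) k as)
               ≈ addP (t^[ v xor true ] addP (Y c) (Y (not c))) (t^[ v xor false ] addP (Y c) (Y (not c)))
    rearranged = begin
      addP (addP (t^[ v xor true ] Y c) (t^[ v xor false ] signSum k false false (not c) as))
           (addP (t^[ v xor true ] Y (not c)) (t^[ v xor false ] signSum k false false (not (not c)) as))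
        ≈⟨ addP-cong (addP-congʳ (t^[ v xor true ] Y c) (t^-cong (v xor false) (complement-even k true true (not c))))
                     (addP-congʳ (t^[ v xor true ] Y (not c)) (t^-cong (v xor false)
                       (≈-trans (complement-even k true true (not (not c))) (≈-reflexive (cong Y (not-involutive c)))))) ⟩
      addP (addP (t^[ v xor true ] Y c) (t^[ v xor false ] Y (not c)))
           (addP (t^[ v xor true ] Y (not c)) (t^[ v xor false ] Y c))
        ≈⟨ addP-interchange (t^[ v xor true ] Y c) _ _ _ ⟩
      addP (addP (t^[ v xor true ] Y c) (t^[ v xor true ] Y (not c)))
           (addP (t^[ v xor false ] Y (not c)) (t^[ v xor false ] Y c))
        ≈⟨ addP-congʳ (addP (t^[ v xor true ] Y c) (t^[ v xor true ] Y (not c))) (addP-comm (t^[ v xor false ] Y (not c)) _) ⟩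
      addP (addP (t^[ v xor true ] Y c) (t^[ v xor true ] Y (not c)))
           (addP (t^[ v xor false ] Y c) (t^[ v xor false ] Y (not c)))
        ≡⟨ cong₂ addP (t^-addP (v xor true) (Y c) (Y (not c))) (t^-addP (v xor false) (Y c) (Y (not c))) ⟨
      addP (t^[ v xor true ] addP (Y c) (Y (not c))) (t^[ v xor false ] addP (Y c) (Y (not c)))
        ∎

  -- If j > k, the ascent into k is the negated sign of j, whatever the sign of k.
  sign-pair-descent-∣ : ∀ k v c →
    [1+t]^ suc ⌊ length as /2⌋ ∣ addP (signSumStep false true v c k as) (signSumStep false false v (not c) k as)
  sign-pair-descent-∣ k v c =
    ∣-resp-≈ (≈-sym rearranged)
      (∣-resp-≈ (addP-comm (t^[ v xor true ] Z) (t^[ v xor false ] Z))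
        (∣-t^-xor-pair v (∣-addP (as∣ k true false c) (as∣ k false false (not c)))))
    where
    open ≈-Reasoning
    Z : Poly
    Z = addP (signSum k true false c as) (signSum k false false (not c) as)
    rearranged : addP (signSumStep false true v c k as) (signSumStep false false v (not c) k as)
               ≈ addP (t^[ v xor false ] Z) (t^[ v xor true ] Z)
    rearranged = addP-cong (≈-reflexive (sym (t^-addP (v xor false) _ _))) (begin
      addP (t^[ v xor true ] signSum k true true (not c) as) (t^[ v xor true ] signSum k false true (not (not c)) as)
        ≈⟨ addP-cong (t^-cong (v xor true) (complement-even k false false (not c)))
                     (t^-cong (v xor true) (≈-trans (complement-even k true false (not (not c)))
                                                    (≈-reflexive (cong (λ c′ → signSum k true false c′ as) (not-involutive c))))) ⟩
      addP (t^[ v xor true ] signSum k false false (not c) as) (t^[ v xor true ] signSum k true false c as)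
        ≈⟨ addP-comm (t^[ v xor true ] signSum k false false (not c) as) _ ⟩
      addP (t^[ v xor true ] signSum k true false c as) (t^[ v xor true ] signSum k false false (not c) as)
        ≡⟨ t^-addP (v xor true) _ _ ⟨
      t^[ v xor true ] Z
        ∎)

  -- Expanding the next letter k and using the complement symmetry on the even-length tail as, the four
  -- resulting terms pair up as p + t p.
  signSum-sign-pair-∣ : ∀ j k v c →
    [1+t]^ suc ⌊ length as /2⌋ ∣ addP (signSum j true v c (k ∷ as)) (signSum j false v (not c) (k ∷ as))
  signSum-sign-pair-∣ j k v c with j ℕ.<ᵇ k
  ... | true  = sign-pair-ascent-∣ k v c
  ... | false = sign-pair-descent-∣ k v c

  -- When the previous letter i is below j, the two signs of j give complementary ascent bits, and (the
  -- tail k ∷ as having odd length) the complement symmetry makes the two branches equal.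
  signSumStep-even-∣ : ∀ j k → (∀ c → [1+t]^ ⌊ length as /2⌋ ∣ signSum j true true c (k ∷ as)) →
    ∀ smaller s u c → [1+t]^ suc ⌊ length as /2⌋ ∣ signSumStep smaller s u c j (k ∷ as)
  signSumStep-even-∣ j k jkas∣ true  s u c = ∣-resp-≈ (≈-sym equal-branches) (∣-t^-xor-pair u (jkas∣ c))
    where
    equal-branches : signSumStep true s u c j (k ∷ as)
                   ≈ addP (t^[ u xor true ] signSum j true true c (k ∷ as)) (t^[ u xor false ] signSum j true true c (k ∷ as))
    equal-branches = addP-congʳ (t^[ u xor true ] signSum j true true c (k ∷ as)) (t^-cong (u xor false)
      (≈-trans (complement-odd j k true true (not c))
               (≈-reflexive (cong (λ c′ → signSum j true true c′ (k ∷ as)) (not-involutive c)))))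
  signSumStep-even-∣ j k _     false s u c =
    ∣-resp-≈ (≈-reflexive (t^-addP (u xor not s) _ _)) (∣-t^ (u xor not s) (signSum-sign-pair-∣ j k (not s) c))

signSumStep-∣ : ∀ as j k →
  (∀ i s u c → [1+t]^ ⌊ length as /2⌋ ∣ signSum i s u c as) →
  (∀ i s u c → [1+t]^ ⌊ suc (length as) /2⌋ ∣ signSum i s u c (k ∷ as)) →
  ∀ smaller s u c → [1+t]^ suc ⌊ length as /2⌋ ∣ signSumStep smaller s u c j (k ∷ as)
signSumStep-∣ as j k as∣ kas∣ smaller s u c with odd (length as) in parity
... | true  = ∣-addP (∣-t^ (u xor A true) (kas∣′ true (A true) c)) (∣-t^ (u xor A false) (kas∣′ false (A false) (not c)))
  where
  A = ascentBit smaller s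
  kas∣′ : ∀ b u′ c′ → [1+t]^ suc ⌊ length as /2⌋ ∣ signSum j b u′ c′ (k ∷ as)
  kas∣′ b u′ c′ =
    subst (λ m → [1+t]^ m ∣ signSum j b u′ c′ (k ∷ as)) (⌊1+n/2⌋≡1+⌊n/2⌋ (length as) parity) (kas∣ j b u′ c′)
... | false = signSumStep-even-∣ as parity as∣ j k kas∣′ smaller s u c
  where
  kas∣′ : ∀ c′ → [1+t]^ ⌊ length as /2⌋ ∣ signSum j true true c′ (k ∷ as)
  kas∣′ c′ =
    subst (λ m → [1+t]^ m ∣ signSum j true true c′ (k ∷ as)) (⌊1+n/2⌋≡⌊n/2⌋ (length as) parity) (kas∣ j true true c′)

signSum-∣ : ∀ as i s u c → [1+t]^ ⌊ length as /2⌋ ∣ signSum i s u c as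
signSum-∣ []           i s u c = [1+t]^0∣ _
signSum-∣ (j ∷ [])     i s u c = [1+t]^0∣ _
signSum-∣ (j ∷ k ∷ as) i s u c = signSumStep-∣ as j k (signSum-∣ as) (signSum-∣ (k ∷ as)) (i ℕ.<ᵇ j) s u c

-- Fibres over a word of absolute values

does-≟ᵇ-true : ∀ b → does (b ≟ᵇ true) ≡ b
does-≟ᵇ-true true  = refl
does-≟ᵇ-true false = refl

does-isEven-≟ᵇ : ∀ n b → does (isEven n ≟ᵇ b) ≡ odd n xor b
does-isEven-≟ᵇ n b = trans (cong (λ x → does (x ≟ᵇ b)) (isEven≡not-odd n)) (does-not-≟ᵇ (odd n) b)
  where
  does-not-≟ᵇ : ∀ x b → does (not x ≟ᵇ b) ≡ x xor b
  does-not-≟ᵇ true  true  = refl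
  does-not-≟ᵇ true  false = refl
  does-not-≟ᵇ false true  = refl
  does-not-≟ᵇ false false = refl

distinct-zipWith-signedVal : ∀ a e → length e ≡ length a →
  does (distinct (map ∣_∣ (zipWith signedVal a e)) ≟ᵇ true) ≡ distinct a
distinct-zipWith-signedVal a e len = begin
  does (distinct (map ∣_∣ (zipWith signedVal a e)) ≟ᵇ true) ≡⟨ does-≟ᵇ-true _ ⟩
  distinct (map ∣_∣ (zipWith signedVal a e))               ≡⟨ cong distinct (map-∣∣-zipWith-signedVal a e len) ⟩
  distinct (map suc a)                                      ≡⟨ distinct-map-suc a ⟩
  distinct a                                                ∎
  where open ≡-Reasoning

0<ᵇsignedVal : ∀ i b → ((+ 0) <ᵇ signedVal i b) ≡ b
0<ᵇsignedVal i true  = refl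
0<ᵇsignedVal i false = refl

sameParity : Bool → List ℤ → Poly
sameParity parity w = select (does (isEven (invB w) ≟ᵇ parity)) (monomial (altrunsB w))

altrunsSummand : Bool → List ℤ → Poly
altrunsSummand parity w = select (does (distinct (map ∣_∣ w) ≟ᵇ true)) (sameParity parity w)

altrunsPoly-B : ∀ parity n →
  altrunsPoly (filter (λ π → isEven (invB π) ≟ᵇ parity) (B n)) ≡ sumP (altrunsSummand parity) (listsOf n (signedVals n))
altrunsPoly-B parity n = trans (sumP-filter _ (λ π → monomial (altrunsB π)) (B n)) (sumP-filter _ _ (listsOf n (signedVals n)))

altrunsSummand-zipWith-signedVal : ∀ parity i as b e → distinct (i ∷ as) ≡ true → length e ≡ length as →
  altrunsSummand parity (zipWith signedVal (i ∷ as) (b ∷ e))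
    ≈ t· select (odd (negatives e) xor (not b xor (odd (inversions (i ∷ as)) xor parity)))
                (monomial (changes (b ∷ ascentBits i b as e)))
altrunsSummand-zipWith-signedVal parity i as b e i∷as-distinct len = ≈-trans (≈-reflexive (begin
  altrunsSummand parity w
    ≡⟨ cong (λ d → select d (sameParity parity w))
            (trans (distinct-zipWith-signedVal (i ∷ as) (b ∷ e) (cong suc len)) i∷as-distinct) ⟩
  select (does (isEven (invB w) ≟ᵇ parity)) (monomial (altrunsB w))
    ≡⟨ cong₂ select keep (cong monomial runs) ⟩
  select (odd (negatives e) xor (not b xor c₀)) (monomial (suc (changes (b ∷ ascentBits i b as e))))
    ∎)) (select-t^ _ true _)
  where
  open ≡-Reasoning
  w = zipWith signedVal (i ∷ as) (b ∷ e)
  c₀ = odd (inversions (i ∷ as)) xor parity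
  i∷as-≢ : AllPairs _≢_ (i ∷ as)
  i∷as-≢ = distinct⇒AllPairs≢ (i ∷ as) i∷as-distinct
  keep : does (isEven (invB w) ≟ᵇ parity) ≡ odd (negatives e) xor (not b xor c₀)
  keep = begin
    does (isEven (invB w) ≟ᵇ parity)
      ≡⟨ does-isEven-≟ᵇ (invB w) parity ⟩
    odd (invB w) xor parity
      ≡⟨ cong (_xor parity) (odd-invB-zipWith-signedVal (i ∷ as) (b ∷ e) i∷as-≢ (cong suc len)) ⟩
    (odd (inversions (i ∷ as)) xor odd (negatives (b ∷ e))) xor parity
      ≡⟨ xor-xy∙z≈y∙xz (odd (inversions (i ∷ as))) (odd (negatives (b ∷ e))) parity ⟩
    odd (negatives (b ∷ e)) xor c₀
      ≡⟨ cong (_xor c₀) (odd-count-∷ not b e) ⟩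
    (not b xor odd (negatives e)) xor c₀
      ≡⟨ xor-xy∙z≈y∙xz (not b) (odd (negatives e)) c₀ ⟩
    odd (negatives e) xor (not b xor c₀)
      ∎
  runs : altrunsB w ≡ suc (changes (b ∷ ascentBits i b as e))
  runs = begin
    altrunsB w
      ≡⟨ altrunsB≡1+changes (0≢signedVal i b ∷ zipWith-signedVal-linked b e (AllPairs⇒Linked i∷as-≢)) ⟩
    suc (changes (((+ 0) <ᵇ signedVal i b) ∷ ascents (signedVal i b ∷ zipWith signedVal as e)))
      ≡⟨ cong (λ us → suc (changes us))
              (cong₂ _∷_ (0<ᵇsignedVal i b) (ascents-zipWith-signedVal b e (AllPairs⇒Linked i∷as-≢))) ⟩
    suc (changes (b ∷ ascentBits i b as e))
      ∎

sumP-altrunsSummand-fibre : ∀ parity i as → distinct (i ∷ as) ≡ true →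
  let c₀ = odd (inversions (i ∷ as)) xor parity in
  sumP (λ e → altrunsSummand parity (zipWith signedVal (i ∷ as) e)) (listsOf (suc (length as)) bools)
    ≈ addP (t· signSum i true true c₀ as) (t· signSum i false false (not c₀) as)
sumP-altrunsSummand-fibre parity i as i∷as-distinct =
  ≈-trans (sumP-listsOf-bools (λ e → altrunsSummand parity (zipWith signedVal (i ∷ as) e)) (length as))
          (addP-cong (sign-branch true) (sign-branch false))
  where
  open ≈-Reasoning
  c₀ = odd (inversions (i ∷ as)) xor parity
  sign-branch : ∀ b → sumP (λ e → altrunsSummand parity (zipWith signedVal (i ∷ as) (b ∷ e))) (listsOf (length as) bools)
                    ≈ t· signSum i b b (not b xor c₀) as
  sign-branch b = begin
    sumP (λ e → altrunsSummand parity (zipWith signedVal (i ∷ as) (b ∷ e))) (listsOf (length as) bools)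
      ≈⟨ sumP-cong (listsOf (length as) bools)
           (All.map (λ {e} → altrunsSummand-zipWith-signedVal parity i as b e i∷as-distinct) (listsOf-length (length as) bools)) ⟩
    sumP (λ e → t· H e) (listsOf (length as) bools)
      ≈⟨ sumP-t^ true H (listsOf (length as) bools) ⟩
    t· sumP H (listsOf (length as) bools)
      ≈⟨ t·-cong (sumP-signSum as i b b (not b xor c₀)) ⟩
    t· signSum i b b (not b xor c₀) as
      ∎
    where
    H : List Bool → Poly
    H e = select (odd (negatives e) xor (not b xor c₀)) (monomial (changes (b ∷ ascentBits i b as e)))

fibre-∣ : ∀ parity i as →
  [1+t]^ ⌊ length as /2⌋ ∣ sumP (λ e → altrunsSummand parity (zipWith signedVal (i ∷ as) e)) (listsOf (suc (length as)) bools)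
fibre-∣ parity i as with distinct (i ∷ as) in i∷as-distinct
... | false = ∣-sumP (All.map (λ {e} len → subst ([1+t]^ ⌊ length as /2⌋ ∣_) (sym (vanishes e len)) (∣[] _))
                              (listsOf-length (suc (length as)) bools))
  where
  vanishes : ∀ e → length e ≡ suc (length as) → altrunsSummand parity (zipWith signedVal (i ∷ as) e) ≡ []
  vanishes e len = cong (λ d → select d (sameParity parity (zipWith signedVal (i ∷ as) e)))
                        (trans (distinct-zipWith-signedVal (i ∷ as) e len) i∷as-distinct)
... | true  = ∣-resp-≈ (≈-sym (sumP-altrunsSummand-fibre parity i as i∷as-distinct))
                       (∣-addP (∣-t^ true (signSum-∣ as i true true c₀)) (∣-t^ true (signSum-∣ as i false false (not c₀))))
  where c₀ = odd (inversions (i ∷ as)) xor parity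

altrunsPoly-∣ : ∀ parity n → [1+t]^ ⌊ (n ∸ 1) /2⌋ ∣ altrunsPoly (filter (λ π → isEven (invB π) ≟ᵇ parity) (B n))
altrunsPoly-∣ parity zero    = [1+t]^0∣ _
altrunsPoly-∣ parity (suc n) = subst ([1+t]^ ⌊ n /2⌋ ∣_) (sym (altrunsPoly-B parity (suc n)))
  (∣-resp-≈ (≈-sym (sumP-listsOf-signedVals (suc n) (suc n) (altrunsSummand parity)))
            (∣-sumP (All.map (λ {a} → fibre {a}) (listsOf-length (suc n) (upTo (suc n))))))
  where
  fibre : ∀ {a} → length a ≡ suc n →
    [1+t]^ ⌊ n /2⌋ ∣ sumP (λ e → altrunsSummand parity (zipWith signedVal a e)) (listsOf (suc n) bools)
  fibre {[]}     ()
  fibre {i ∷ as} len =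
    subst (λ m → [1+t]^ ⌊ m /2⌋ ∣ sumP (λ e → altrunsSummand parity (zipWith signedVal (i ∷ as) e)) (listsOf (suc m) bools))
          (ℕ.suc-injective len) (fibre-∣ parity i as)

theorem39 : (n : ℕ) → 1 ≤ n →
    (powP onePlusT ⌊ (n ∸ 1) /2⌋ ∣P RBplus n)
      × (powP onePlusT ⌊ (n ∸ 1) /2⌋ ∣P RBminus n)
theorem39 n _ = ∣⇒∣P (altrunsPoly-∣ true n) , ∣⇒∣P (altrunsPoly-∣ false n)
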